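{- Let $C$ be a context, $F$ a finite process, $\alpha$ an action and $P$ a process. If $C[0]\sim\ !\alpha.F|P$, then $C[0]\sim C[\alpha.F]$.
   Context: Fix a countable set of actions $\alpha,\beta$. Finite processes: $F ::= 0 \mid \alpha.F \mid F|F$. Processes: $P ::= F \mid\ !\alpha.F \mid P|P$. Finite single-hole contexts: $D ::= [\,] \mid \alpha.D \mid D|F$; contexts: $C ::= D \mid\ !\alpha.D \mid C|P$; $C[F]$ fills the hole with the finite process $F$. Transitions: $\alpha.F\xrightarrow{\alpha}F$; $!\alpha.F\xrightarrow{\alpha}\ !\alpha.F|F$; if $P_1\xrightarrow{\alpha}P_1'$ then $P_1|P_2\xrightarrow{\alpha}P_1'|P_2$ and $P_2|P_1\xrightarrow{\alpha}P_2|P_1'$. $\sim$ is strong bisimilarity: the largest symmetric relation $\mathcal R$ such that $P\mathcal RQ$ and $P\xrightarrow{\alpha}P'$ imply $Q\xrightarrow{\alpha}Q'$ with $P'\mathcal RQ'$. -}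

module Defs where

open import Level using (0ℓ)
open import Data.Product using (Σ; _×_)

module _ (Act : Set) where

  data Fin : Set where
    𝟘   : Fin
    _·_ : Act → Fin → Fin
    _∥_ : Fin → Fin → Fin

  data Proc : Set where
    fin  : Fin → Proc
    !_·_ : Act → Fin → Proc
    _∣_  : Proc → Proc → Proc

  data FCtx : Set where
    []   : FCtx
    _·ᴰ_ : Act → FCtx → FCtx
    _∥ᴰ_ : FCtx → Fin → FCtx

  data Ctx : Set where
    ctx   : FCtx → Ctx
    !ᶜ_·_ : Act → FCtx → Ctx
    _∣ᶜ_  : Ctx → Proc → Ctx

  fillᴰ : FCtx → Fin → Fin
  fillᴰ []         F = F
  fillᴰ (a ·ᴰ D)   F = a · fillᴰ D F
  fillᴰ (D ∥ᴰ F′)  F = fillᴰ D F ∥ F′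

  fill : Ctx → Fin → Proc
  fill (ctx D)    F = fin (fillᴰ D F)
  fill (!ᶜ a · D) F = ! a · fillᴰ D F
  fill (C ∣ᶜ P)   F = fill C F ∣ P

  data _—F[_]→_ : Fin → Act → Fin → Set where
    pre  : ∀ {a F} → (a · F) —F[ a ]→ F
    parL : ∀ {a F₁ F₁′ F₂} → F₁ —F[ a ]→ F₁′ → (F₁ ∥ F₂) —F[ a ]→ (F₁′ ∥ F₂)
    parR : ∀ {a F₁ F₂ F₂′} → F₂ —F[ a ]→ F₂′ → (F₁ ∥ F₂) —F[ a ]→ (F₁ ∥ F₂′)

  data _—[_]→_ : Proc → Act → Proc → Set where
    fin→ : ∀ {a F F′} → F —F[ a ]→ F′ → fin F —[ a ]→ fin F′
    rep  : ∀ {a F} → (! a · F) —[ a ]→ ((! a · F) ∣ fin F)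
    parL : ∀ {a P₁ P₁′ P₂} → P₁ —[ a ]→ P₁′ → (P₁ ∣ P₂) —[ a ]→ (P₁′ ∣ P₂)
    parR : ∀ {a P₁ P₂ P₂′} → P₂ —[ a ]→ P₂′ → (P₁ ∣ P₂) —[ a ]→ (P₁ ∣ P₂′)

  IsBisim : (Proc → Proc → Set) → Set
  IsBisim R =
    (∀ {P Q} → R P Q → R Q P) ×
    (∀ {P Q a P′} → R P Q → P —[ a ]→ P′ → Σ Proc λ Q′ → (Q —[ a ]→ Q′) × R P′ Q′)

  _∼_ : Proc → Proc → Set₁
  P ∼ Q = Σ (Proc → Proc → Set) λ R → IsBisim R × R P Q

-- Let R witness C[0] ∼ !α.F | P. Close R under equivalence, parallel composition and
-- structural congruence, and additionally relate Q to every Y obtained from Q by replacing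
-- some occurrences of 0 by α.F, provided Q is still related to !α.F | W for some W. This
-- closure is a bisimulation and relates C[0] to C[α.F]. Moves of Y not touching a plugged
-- α.F are mirrored by Q. When Y fires a plugged α.F, becoming Y₀ | F, Q answers by firing
-- the replicated !α.F of its partner, reaching a state related to Q | F and hence to Y₀ | F.
-- The proviso is preserved by all moves of Q, since a move of !α.F | W is again of that form.
module Submission where

open import Defs
open import Data.Nat using (ℕ)
open import Data.Product using (∃-syntax; _×_; _,_; proj₁; proj₂)
open import Data.Sum using (_⊎_; inj₁; inj₂)
open import Function using (flip)
open import Function.Bundles using (_↣_)
open import Relation.Binary.PropositionalEquality as ≡ using (_≡_)

Simulation : {S L : Set} → (S → L → S → Set) → (S → S → Set) → (S → S → Set) → Set
Simulation _⟶[_]_ R R′ =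
  ∀ {P Q a P′} → R P Q → P ⟶[ a ] P′ → ∃[ Q′ ] Q ⟶[ a ] Q′ × R′ P′ Q′

module Bisimilarity (Act : Set) where

  private
    Pr : Set
    Pr = Proc Act

    Fn : Set
    Fn = Fin Act

    _⟶[_]_ : Pr → Act → Pr → Set
    _⟶[_]_ = _—[_]→_ Act

    _⟶ᶠ[_]_ : Fn → Act → Fn → Set
    _⟶ᶠ[_]_ = _—F[_]→_ Act

    variable
      P P′ Q Q′ R : Pr
      X Y Z : Fn
      b : Act

  infix 4 _≡ₛ_

  data _≡ₛ_ : Pr → Pr → Set where
    refl        : P ≡ₛ P
    sym         : P ≡ₛ Q → Q ≡ₛ P
    trans       : P ≡ₛ Q → Q ≡ₛ R → P ≡ₛ R
    ∣-cong      : P ≡ₛ P′ → Q ≡ₛ Q′ → P ∣ Q ≡ₛ P′ ∣ Q′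
    ∣-assoc     : (P ∣ Q) ∣ R ≡ₛ P ∣ (Q ∣ R)
    ∣-comm      : P ∣ Q ≡ₛ Q ∣ P
    ∣-identityˡ : fin 𝟘 ∣ P ≡ₛ P
    fin-∥       : fin (X ∥ Y) ≡ₛ fin X ∣ fin Y

  ∣-pullˡ : P′ ≡ₛ P ∣ R → P′ ∣ Q ≡ₛ (P ∣ Q) ∣ R
  ∣-pullˡ e = trans (∣-cong e refl) (trans ∣-assoc (trans (∣-cong refl ∣-comm) (sym ∣-assoc)))

  ∣-pullʳ : Q′ ≡ₛ Q ∣ R → P ∣ Q′ ≡ₛ (P ∣ Q) ∣ R
  ∣-pullʳ e = trans (∣-cong refl e) (sym ∣-assoc)

  fin-∥-pullˡ : fin Z ≡ₛ fin X ∣ R → fin (Z ∥ Y) ≡ₛ fin (X ∥ Y) ∣ R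
  fin-∥-pullˡ e = trans fin-∥ (trans (∣-pullˡ e) (∣-cong (sym fin-∥) refl))

  fin-∥-pullʳ : fin Z ≡ₛ fin Y ∣ R → fin (X ∥ Z) ≡ₛ fin (X ∥ Y) ∣ R
  fin-∥-pullʳ e = trans fin-∥ (trans (∣-pullʳ e) (∣-cong (sym fin-∥) refl))

  mutual
    ≡ₛ-sim : Simulation _⟶[_]_ _≡ₛ_ _≡ₛ_
    ≡ₛ-sim refl s = _ , s , refl
    ≡ₛ-sim (sym e) s with ≡ₛ-sim⁻¹ e s
    ... | _ , t , e′ = _ , t , sym e′
    ≡ₛ-sim (trans e₁ e₂) s with ≡ₛ-sim e₁ s
    ... | _ , t , e₁′ with ≡ₛ-sim e₂ t
    ... | _ , u , e₂′ = _ , u , trans e₁′ e₂′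
    ≡ₛ-sim (∣-cong e₁ e₂) (parL s) with ≡ₛ-sim e₁ s
    ... | _ , t , e′ = _ , parL t , ∣-cong e′ e₂
    ≡ₛ-sim (∣-cong e₁ e₂) (parR s) with ≡ₛ-sim e₂ s
    ... | _ , t , e′ = _ , parR t , ∣-cong e₁ e′
    ≡ₛ-sim ∣-assoc (parL (parL s)) = _ , parL s , ∣-assoc
    ≡ₛ-sim ∣-assoc (parL (parR s)) = _ , parR (parL s) , ∣-assoc
    ≡ₛ-sim ∣-assoc (parR s) = _ , parR (parR s) , ∣-assoc
    ≡ₛ-sim ∣-comm (parL s) = _ , parR s , ∣-comm
    ≡ₛ-sim ∣-comm (parR s) = _ , parL s , ∣-comm
    ≡ₛ-sim ∣-identityˡ (parL (fin→ ()))
    ≡ₛ-sim ∣-identityˡ (parR s) = _ , s , ∣-identityˡ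
    ≡ₛ-sim fin-∥ (fin→ (parL s)) = _ , parL (fin→ s) , fin-∥
    ≡ₛ-sim fin-∥ (fin→ (parR s)) = _ , parR (fin→ s) , fin-∥

    ≡ₛ-sim⁻¹ : Simulation _⟶[_]_ (flip _≡ₛ_) (flip _≡ₛ_)
    ≡ₛ-sim⁻¹ refl s = _ , s , refl
    ≡ₛ-sim⁻¹ (sym e) s with ≡ₛ-sim e s
    ... | _ , t , e′ = _ , t , sym e′
    ≡ₛ-sim⁻¹ (trans e₁ e₂) s with ≡ₛ-sim⁻¹ e₂ s
    ... | _ , t , e₂′ with ≡ₛ-sim⁻¹ e₁ t
    ... | _ , u , e₁′ = _ , u , trans e₁′ e₂′
    ≡ₛ-sim⁻¹ (∣-cong e₁ e₂) (parL s) with ≡ₛ-sim⁻¹ e₁ s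
    ... | _ , t , e′ = _ , parL t , ∣-cong e′ e₂
    ≡ₛ-sim⁻¹ (∣-cong e₁ e₂) (parR s) with ≡ₛ-sim⁻¹ e₂ s
    ... | _ , t , e′ = _ , parR t , ∣-cong e₁ e′
    ≡ₛ-sim⁻¹ ∣-assoc (parL s) = _ , parL (parL s) , ∣-assoc
    ≡ₛ-sim⁻¹ ∣-assoc (parR (parL s)) = _ , parL (parR s) , ∣-assoc
    ≡ₛ-sim⁻¹ ∣-assoc (parR (parR s)) = _ , parR s , ∣-assoc
    ≡ₛ-sim⁻¹ ∣-comm (parL s) = _ , parR s , ∣-comm
    ≡ₛ-sim⁻¹ ∣-comm (parR s) = _ , parL s , ∣-comm
    ≡ₛ-sim⁻¹ ∣-identityˡ s = _ , parR s , ∣-identityˡ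
    ≡ₛ-sim⁻¹ fin-∥ (parL (fin→ s)) = _ , fin→ (parL s) , fin-∥
    ≡ₛ-sim⁻¹ fin-∥ (parR (fin→ s)) = _ , fin→ (parR s) , fin-∥

  module Plugging (a : Act) (F : Fn) where

    infix 4 _≼ᶠ_ _≼_

    data _≼ᶠ_ : Fn → Fn → Set where
      ≼-𝟘    : 𝟘 ≼ᶠ 𝟘
      ≼-plug : 𝟘 ≼ᶠ a · F
      ≼-·    : X ≼ᶠ Y → b · X ≼ᶠ b · Y
      ≼-∥    : ∀ {X′ Y′} → X ≼ᶠ Y → X′ ≼ᶠ Y′ → X ∥ X′ ≼ᶠ Y ∥ Y′

    data _≼_ : Pr → Pr → Set where
      ≼-fin : X ≼ᶠ Y → fin X ≼ fin Y
      ≼-!   : X ≼ᶠ Y → ! b · X ≼ ! b · Y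
      ≼-∣   : P ≼ Q → P′ ≼ Q′ → P ∣ P′ ≼ Q ∣ Q′

    ≼ᶠ-refl : ∀ X → X ≼ᶠ X
    ≼ᶠ-refl 𝟘 = ≼-𝟘
    ≼ᶠ-refl (b · X) = ≼-· (≼ᶠ-refl X)
    ≼ᶠ-refl (X ∥ Y) = ≼-∥ (≼ᶠ-refl X) (≼ᶠ-refl Y)

    ≼-refl : ∀ P → P ≼ P
    ≼-refl (fin X) = ≼-fin (≼ᶠ-refl X)
    ≼-refl (! b · X) = ≼-! (≼ᶠ-refl X)
    ≼-refl (P ∣ Q) = ≼-∣ (≼-refl P) (≼-refl Q)

    fillᴰ-≼ᶠ : ∀ D → fillᴰ Act D 𝟘 ≼ᶠ fillᴰ Act D (a · F)
    fillᴰ-≼ᶠ [] = ≼-plug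
    fillᴰ-≼ᶠ (b ·ᴰ D) = ≼-· (fillᴰ-≼ᶠ D)
    fillᴰ-≼ᶠ (D ∥ᴰ X) = ≼-∥ (fillᴰ-≼ᶠ D) (≼ᶠ-refl X)

    fill-≼ : ∀ C → fill Act C 𝟘 ≼ fill Act C (a · F)
    fill-≼ (ctx D) = ≼-fin (fillᴰ-≼ᶠ D)
    fill-≼ (!ᶜ b · D) = ≼-! (fillᴰ-≼ᶠ D)
    fill-≼ (C ∣ᶜ P) = ≼-∣ (fill-≼ C) (≼-refl P)

    ≼ᶠ-sim : Simulation _⟶ᶠ[_]_ _≼ᶠ_ _≼ᶠ_
    ≼ᶠ-sim (≼-· p) pre = _ , pre , p
    ≼ᶠ-sim (≼-∥ p q) (parL s) with ≼ᶠ-sim p s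
    ... | _ , t , p′ = _ , parL t , ≼-∥ p′ q
    ≼ᶠ-sim (≼-∥ p q) (parR s) with ≼ᶠ-sim q s
    ... | _ , t , q′ = _ , parR t , ≼-∥ p q′

    ≼-sim : Simulation _⟶[_]_ _≼_ _≼_
    ≼-sim (≼-fin p) (fin→ s) with ≼ᶠ-sim p s
    ... | _ , t , p′ = _ , fin→ t , ≼-fin p′
    ≼-sim (≼-! p) rep = _ , rep , ≼-∣ (≼-! p) (≼-fin p)
    ≼-sim (≼-∣ p q) (parL s) with ≼-sim p s
    ... | _ , t , p′ = _ , parL t , ≼-∣ p′ q
    ≼-sim (≼-∣ p q) (parR s) with ≼-sim q s
    ... | _ , t , q′ = _ , parR t , ≼-∣ p q′

    Firedᶠ : Fn → Act → Fn → Set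
    Firedᶠ X b Y′ = b ≡ a × ∃[ Y₀ ] X ≼ᶠ Y₀ × fin Y′ ≡ₛ fin Y₀ ∣ fin F

    Fired : Pr → Act → Pr → Set
    Fired P b Q′ = b ≡ a × ∃[ Q₀ ] P ≼ Q₀ × Q′ ≡ₛ Q₀ ∣ fin F

    ≼ᶠ-sim⁻¹ : ∀ {Y′} → X ≼ᶠ Y → Y ⟶ᶠ[ b ] Y′ →
               (∃[ X′ ] X ⟶ᶠ[ b ] X′ × X′ ≼ᶠ Y′) ⊎ Firedᶠ X b Y′
    ≼ᶠ-sim⁻¹ ≼-plug pre = inj₂ (≡.refl , 𝟘 , ≼-𝟘 , sym ∣-identityˡ)
    ≼ᶠ-sim⁻¹ (≼-· p) pre = inj₁ (_ , pre , p)
    ≼ᶠ-sim⁻¹ (≼-∥ p q) (parL s) with ≼ᶠ-sim⁻¹ p s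
    ... | inj₁ (_ , t , p′) = inj₁ (_ , parL t , ≼-∥ p′ q)
    ... | inj₂ (b≡a , _ , p₀ , e) = inj₂ (b≡a , _ , ≼-∥ p₀ q , fin-∥-pullˡ e)
    ≼ᶠ-sim⁻¹ (≼-∥ p q) (parR s) with ≼ᶠ-sim⁻¹ q s
    ... | inj₁ (_ , t , q′) = inj₁ (_ , parR t , ≼-∥ p q′)
    ... | inj₂ (b≡a , _ , q₀ , e) = inj₂ (b≡a , _ , ≼-∥ p q₀ , fin-∥-pullʳ e)

    ≼-sim⁻¹ : P ≼ Q → Q ⟶[ b ] Q′ → (∃[ P′ ] P ⟶[ b ] P′ × P′ ≼ Q′) ⊎ Fired P b Q′
    ≼-sim⁻¹ (≼-fin p) (fin→ s) with ≼ᶠ-sim⁻¹ p s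
    ... | inj₁ (_ , t , p′) = inj₁ (_ , fin→ t , ≼-fin p′)
    ... | inj₂ (b≡a , _ , p₀ , e) = inj₂ (b≡a , _ , ≼-fin p₀ , e)
    ≼-sim⁻¹ (≼-! p) rep = inj₁ (_ , rep , ≼-∣ (≼-! p) (≼-fin p))
    ≼-sim⁻¹ (≼-∣ p q) (parL s) with ≼-sim⁻¹ p s
    ... | inj₁ (_ , t , p′) = inj₁ (_ , parL t , ≼-∣ p′ q)
    ... | inj₂ (b≡a , _ , p₀ , e) = inj₂ (b≡a , _ , ≼-∣ p₀ q , ∣-pullˡ e)
    ≼-sim⁻¹ (≼-∣ p q) (parR s) with ≼-sim⁻¹ q s
    ... | inj₁ (_ , t , q′) = inj₁ (_ , parR t , ≼-∣ p q′)
    ... | inj₂ (b≡a , _ , q₀ , e) = inj₂ (b≡a , _ , ≼-∣ p q₀ , ∣-pullʳ e)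

  module UpTo (R₀ : Pr → Pr → Set) (R₀-bisim : IsBisim Act R₀) (a : Act) (F : Fn) where

    open Plugging a F

    infix 4 _≋_

    data _≋_ : Pr → Pr → Set

    CanFire : Pr → Set
    CanFire Q = ∃[ W ] Q ≋ (! a · F) ∣ W

    data _≋_ where
      base   : R₀ P Q → P ≋ Q
      struct : P ≡ₛ Q → P ≋ Q
      sym    : P ≋ Q → Q ≋ P
      trans  : P ≋ Q → Q ≋ R → P ≋ R
      ∣-cong : P ≋ P′ → Q ≋ Q′ → P ∣ Q ≋ P′ ∣ Q′
      plug   : CanFire P → P ≼ Q → P ≋ Q

    mutual
      ≋-sim : Simulation _⟶[_]_ _≋_ _≋_
      ≋-sim (base r) s with proj₂ R₀-bisim r s
      ... | _ , t , r′ = _ , t , base r′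
      ≋-sim (struct e) s with ≡ₛ-sim e s
      ... | _ , t , e′ = _ , t , struct e′
      ≋-sim (sym e) s with ≋-sim⁻¹ e s
      ... | _ , t , e′ = _ , t , sym e′
      ≋-sim (trans e₁ e₂) s with ≋-sim e₁ s
      ... | _ , t , e₁′ with ≋-sim e₂ t
      ... | _ , u , e₂′ = _ , u , trans e₁′ e₂′
      ≋-sim (∣-cong e₁ e₂) (parL s) with ≋-sim e₁ s
      ... | _ , t , e′ = _ , parL t , ∣-cong e′ e₂
      ≋-sim (∣-cong e₁ e₂) (parR s) with ≋-sim e₂ s
      ... | _ , t , e′ = _ , parR t , ∣-cong e₁ e′
      ≋-sim (plug c p) s with ≼-sim p s
      ... | _ , t , p′ = _ , t , plug (canFire-step c s) p′

      canFire-step : CanFire P → P ⟶[ b ] P′ → CanFire P′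
      canFire-step (_ , e) s with ≋-sim e s
      ... | _ , parL rep , e′ = _ , trans e′ (struct ∣-assoc)
      ... | _ , parR _ , e′ = _ , e′

      ≋-sim⁻¹ : Simulation _⟶[_]_ (flip _≋_) (flip _≋_)
      ≋-sim⁻¹ (base r) s with proj₂ R₀-bisim (proj₁ R₀-bisim r) s
      ... | _ , t , r′ = _ , t , sym (base r′)
      ≋-sim⁻¹ (struct e) s with ≡ₛ-sim⁻¹ e s
      ... | _ , t , e′ = _ , t , struct e′
      ≋-sim⁻¹ (sym e) s with ≋-sim e s
      ... | _ , t , e′ = _ , t , sym e′
      ≋-sim⁻¹ (trans e₁ e₂) s with ≋-sim⁻¹ e₂ s
      ... | _ , t , e₂′ with ≋-sim⁻¹ e₁ t
      ... | _ , u , e₁′ = _ , u , trans e₁′ e₂′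
      ≋-sim⁻¹ (∣-cong e₁ e₂) (parL s) with ≋-sim⁻¹ e₁ s
      ... | _ , t , e′ = _ , parL t , ∣-cong e′ e₂
      ≋-sim⁻¹ (∣-cong e₁ e₂) (parR s) with ≋-sim⁻¹ e₂ s
      ... | _ , t , e′ = _ , parR t , ∣-cong e₁ e′
      ≋-sim⁻¹ (plug c p) s with ≼-sim⁻¹ p s
      ... | inj₁ (_ , t , p′) = _ , t , plug (canFire-step c t) p′
      ... | inj₂ (≡.refl , _ , p₀ , e) = fire-replication c p₀ e

      fire-replication : CanFire P → P ≼ Q → Q′ ≡ₛ Q ∣ fin F → ∃[ P′ ] P ⟶[ a ] P′ × P′ ≋ Q′
      fire-replication c@(_ , e) p e′ with ≋-sim⁻¹ e (parL rep)
      ... | _ , t , e″ = _ , t ,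
        trans e″ (trans (struct (∣-pullˡ refl))
          (trans (∣-cong (sym e) (struct refl))
            (trans (∣-cong (plug c p) (struct refl)) (struct (sym e′)))))

open Bisimilarity

proposition1 : (Act : Set) → Act ↣ ℕ →
    (C : Ctx Act) (F : Fin Act) (a : Act) (P : Proc Act) →
    _∼_ Act (fill Act C (𝟘 {Act})) (_∣_ (!_·_ a F) P) →
    _∼_ Act (fill Act C (𝟘 {Act})) (fill Act C (_·_ a F))
proposition1 Act _ C F a P (R₀ , R₀-bisim , r) =
  _≋_ , (sym , ≋-sim) , plug (P , base r) (fill-≼ C)
  where
    open Plugging Act a F
    open UpTo Act R₀ R₀-bisim a F
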